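{- Let $(C,\sqsubseteq)$ be a complete lattice, $b\colon C\to C$ a monotone map, $a_1,a_2\colon C\to C$ up-closure operators with $a_1\sqsubseteq a_2$ (pointwise), and $f\in C$. If $a_2$ is $(b,f)$-complete, then $a_1$ is $(b,f)$-complete.
   Context: An up-closure operator is a monotone $a$ with $x\sqsubseteq a(x)$ and $a(a(x))\sqsubseteq a(x)$. An up-closure $a$ is $(b,f)$-complete iff (1) $a(f)\sqsubseteq f$ and (2) $\mu(a\circ b)\sqsubseteq f$ iff $\mu b\sqsubseteq f$, where $\mu$ denotes least fixed point. -}

module Defs where

open import Level using (Level; _⊔_; suc)
open import Relation.Binary.Bundles using (Poset)
open import Data.Product using (_×_)
open import Function.Bundles using (_⇔_)

-- A complete lattice: a poset in which every subset (predicate on the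
-- carrier, at the level of the order) has a greatest lower bound.
-- (Existence of all meets is equivalent to existence of all joins; the
--  join of S is the meet of its upper bounds.)
record CompleteLattice (c ℓ₁ ℓ₂ : Level) : Set (suc (c ⊔ ℓ₁ ⊔ ℓ₂)) where
  field
    poset : Poset c ℓ₁ ℓ₂
  open Poset poset public renaming (_≤_ to _⊑_)
  field
    ⋀        : (Carrier → Set ℓ₂) → Carrier
    ⋀-lower  : ∀ (S : Carrier → Set ℓ₂) x → S x → ⋀ S ⊑ x
    ⋀-great  : ∀ (S : Carrier → Set ℓ₂) y → (∀ x → S x → y ⊑ x) → y ⊑ ⋀ S

module _ {c ℓ₁ ℓ₂ : Level} (L : CompleteLattice c ℓ₁ ℓ₂) where
  open CompleteLattice L

  Monotone : (Carrier → Carrier) → Set (c ⊔ ℓ₂)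
  Monotone g = ∀ {x y} → x ⊑ y → g x ⊑ g y

  _⊑̇_ : (Carrier → Carrier) → (Carrier → Carrier) → Set (c ⊔ ℓ₂)
  g ⊑̇ h = ∀ x → g x ⊑ h x

  record IsUpClosure (a : Carrier → Carrier) : Set (c ⊔ ℓ₂) where
    field
      mono       : Monotone a
      extensive  : ∀ x → x ⊑ a x
      idempotent : ∀ x → a (a x) ⊑ a x

  -- least fixed point of a monotone map (Knaster–Tarski):
  -- the meet of all prefixed points
  μ : (Carrier → Carrier) → Carrier
  μ g = ⋀ (λ x → g x ⊑ x)

  _∘'_ : (Carrier → Carrier) → (Carrier → Carrier) → Carrier → Carrier
  (g ∘' h) x = g (h x)

  Complete : (a b : Carrier → Carrier) (f : Carrier) → Set ℓ₂
  Complete a b f = (a f ⊑ f) × ((μ (a ∘' b) ⊑ f) ⇔ (μ b ⊑ f))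

-- The argument only uses that μ is monotone in g:
-- if g ⊑ h pointwise then every prefixed point of h is one of g, so
-- μ g ⊑ μ h.  Since a₁ is extensive and a₁ ⊑ a₂, this gives the sandwich
--     μ b  ⊑  μ (a₁ ∘ b)  ⊑  μ (a₂ ∘ b).
-- Now (1) a₁ f ⊑ a₂ f ⊑ f; and (2) if μ (a₁ ∘ b) ⊑ f then μ b ⊑ f by the
-- left inequality, while if μ b ⊑ f then μ (a₂ ∘ b) ⊑ f by completeness
-- of a₂, hence μ (a₁ ∘ b) ⊑ f by the right inequality.
module Submission where

open import Defs
open import Level using (Level)
open import Data.Product using (_,_)
open import Function.Bundles using (mk⇔; Equivalence)

module _ {c ℓ₁ ℓ₂ : Level} (L : CompleteLattice c ℓ₁ ℓ₂) where
  open CompleteLattice L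

  -- μ is monotone in the map: a prefixed point of the larger map is a
  -- prefixed point of the smaller one, so the meets compare the same way.
  μ-mono : ∀ {g h : Carrier → Carrier} → _⊑̇_ L g h → μ L g ⊑ μ L h
  μ-mono {g} {h} g⊑h =
    ⋀-great (λ x → h x ⊑ x) (μ L g)
      (λ x hx⊑x → ⋀-lower (λ y → g y ⊑ y) x (trans (g⊑h x) hx⊑x))

  ⊑̇-∘-extensive : ∀ (a b : Carrier → Carrier) → (∀ x → x ⊑ a x) →
                  _⊑̇_ L b (_∘'_ L a b)
  ⊑̇-∘-extensive a b extensive x = extensive (b x)

  ⊑̇-∘ʳ : ∀ {a₁ a₂ : Carrier → Carrier} (b : Carrier → Carrier) →
         _⊑̇_ L a₁ a₂ → _⊑̇_ L (_∘'_ L a₁ b) (_∘'_ L a₂ b)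
  ⊑̇-∘ʳ b a₁⊑a₂ x = a₁⊑a₂ (b x)

proposition9p6 : ∀ {c ℓ₁ ℓ₂ : Level} (L : CompleteLattice c ℓ₁ ℓ₂)
    (b a₁ a₂ : CompleteLattice.Carrier L → CompleteLattice.Carrier L)
    (f : CompleteLattice.Carrier L) →
    Monotone L b → IsUpClosure L a₁ → IsUpClosure L a₂ → _⊑̇_ L a₁ a₂ →
    Complete L a₂ b f → Complete L a₁ b f
proposition9p6 L b a₁ a₂ f _ up₁ _ a₁⊑a₂ (a₂f⊑f , a₂-complete) =
  trans (a₁⊑a₂ f) a₂f⊑f , mk⇔ μ₁⊑f⇒μb⊑f μb⊑f⇒μ₁⊑f
  where
  open CompleteLattice L

  μb⊑μ₁ : μ L b ⊑ μ L (_∘'_ L a₁ b)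
  μb⊑μ₁ = μ-mono L (⊑̇-∘-extensive L a₁ b (IsUpClosure.extensive up₁))

  μ₁⊑μ₂ : μ L (_∘'_ L a₁ b) ⊑ μ L (_∘'_ L a₂ b)
  μ₁⊑μ₂ = μ-mono L (⊑̇-∘ʳ L b a₁⊑a₂)

  μ₁⊑f⇒μb⊑f : μ L (_∘'_ L a₁ b) ⊑ f → μ L b ⊑ f
  μ₁⊑f⇒μb⊑f = trans μb⊑μ₁

  μb⊑f⇒μ₁⊑f : μ L b ⊑ f → μ L (_∘'_ L a₁ b) ⊑ f
  μb⊑f⇒μ₁⊑f μb⊑f = trans μ₁⊑μ₂ (Equivalence.from a₂-complete μb⊑f)
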